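{- Every $\mathcal{B}$ graph is Hamiltonian.
   Context: For $n\ge 5$, the bicycle wheel $B_n$ is the graph with $n$ vertices consisting of a cycle (the rim) on $n-2$ vertices, two further vertices (the middle vertices, or hubs) each adjacent to every rim vertex, and an edge joining the two hubs; it has $3n-5$ edges. Edges from a hub to a rim vertex are called spokes. A $\mathcal{B}$ graph is a graph that is either $B_n$ for some $n\ge 5$, or a $3$-connected non-planar graph obtained from $B_n$ (for some $n\ge 5$) by deleting edges. A graph is Hamiltonian if it has a cycle through all its vertices. -}

module Defs where

open import Data.Nat using (ℕ; zero; suc; _+_; _≤_; _<_)
open import Data.Fin using (Fin; toℕ; inject₁; fromℕ) renaming (zero to fzero; suc to fsuc)
open import Data.Product using (Σ; _×_; ∃; ∃-syntax)
open import Data.Sum using (_⊎_)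
open import Data.Empty using (⊥)
open import Relation.Nullary using (¬_)
open import Relation.Binary.PropositionalEquality using (_≡_; _≢_)
open import Function.Definitions using (Injective)
open import Data.Rational using (ℚ; 0ℚ; 1ℚ) renaming (_+_ to _+ℚ_; _*_ to _*ℚ_; _-_ to _-ℚ_; _≤_ to _≤ℚ_)

record Graph (n : ℕ) : Set₁ where
  field
    E      : Fin n → Fin n → Set
    sym    : ∀ {u v} → E u v → E v u
    irrefl : ∀ {u} → ¬ E u u
open Graph public

-- The bicycle wheel B_n.  Vertices 0 and 1 are the hubs, vertices
-- 2, 3, ..., n-1 form the rim cycle 2 - 3 - ... - (n-1) - 2.

data BEdgeℕ (n : ℕ) : ℕ → ℕ → Set where
  hub01   : BEdgeℕ n 0 1
  hub10   : BEdgeℕ n 1 0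
  spokeˡ  : ∀ {h r} → h ≤ 1 → 2 ≤ r → BEdgeℕ n h r
  spokeʳ  : ∀ {h r} → h ≤ 1 → 2 ≤ r → BEdgeℕ n r h
  rimˡ    : ∀ {a} → 2 ≤ a → BEdgeℕ n a (suc a)
  rimʳ    : ∀ {a} → 2 ≤ a → BEdgeℕ n (suc a) a
  closeˡ  : ∀ {l} → suc l ≡ n → BEdgeℕ n 2 l
  closeʳ  : ∀ {l} → suc l ≡ n → BEdgeℕ n l 2

BEdge : (n : ℕ) → Fin n → Fin n → Set
BEdge n u v = BEdgeℕ n (toℕ u) (toℕ v)

SubgraphOfBicycle : ∀ {n} → Graph n → Set
SubgraphOfBicycle {n} G = ∀ u v → E G u v → BEdge n u v

IsBicycle : ∀ {n} → Graph n → Set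
IsBicycle {n} G = ∀ u v → (E G u v → BEdge n u v) × (BEdge n u v → E G u v)

data Reach {n} (G : Graph n) (P : Fin n → Set) : Fin n → Fin n → Set where
  here : ∀ {u} → P u → Reach G P u u
  step : ∀ {u w v} → P u → E G u w → Reach G P w v → Reach G P u v

-- G - {x, y} is connected (x = y allowed, covering removal of one vertex)
ConnectedAvoiding : ∀ {n} → Graph n → Fin n → Fin n → Set
ConnectedAvoiding {n} G x y =
  ∀ u v → u ≢ x → u ≢ y → v ≢ x → v ≢ y →
  Reach G (λ w → w ≢ x × w ≢ y) u v

ThreeConnected : ∀ {n} → Graph n → Set
ThreeConnected {n} G = 3 < n × (∀ x y → ConnectedAvoiding G x y)

Point : Set
Point = ℚ × ℚ

OnSegment : Point → Point → Point → Set
OnSegment (px Data.Product., py) (ax Data.Product., ay) (bx Data.Product., by) =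
  ∃[ t ] (0ℚ ≤ℚ t × t ≤ℚ 1ℚ ×
          px ≡ ax +ℚ t *ℚ (bx -ℚ ax) × py ≡ ay +ℚ t *ℚ (by -ℚ ay))

record PlaneDrawing {n} (G : Graph n) : Set where
  field
    pos       : Fin n → Point
    injective : Injective _≡_ _≡_ pos
    vertexOff : ∀ w u v → E G u v → w ≢ u → w ≢ v →
                ¬ OnSegment (pos w) (pos u) (pos v)
    edgesMeet : ∀ u v w z → E G u v → E G w z →
                ¬ (u ≡ w × v ≡ z) → ¬ (u ≡ z × v ≡ w) →
                ∀ p → OnSegment p (pos u) (pos v) → OnSegment p (pos w) (pos z) →
                (p ≡ pos u ⊎ p ≡ pos v) × (p ≡ pos w ⊎ p ≡ pos z)

Planar : ∀ {n} → Graph n → Set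
Planar G = PlaneDrawing G

Hamiltonian : ∀ {n} → Graph n → Set
Hamiltonian {zero}  G = ⊥
Hamiltonian {suc m} G =
  Σ (Fin (suc m) → Fin (suc m)) λ σ →
    Injective _≡_ _≡_ σ ×
    (∀ (i : Fin m) → E G (σ (inject₁ i)) (σ (fsuc i))) ×
    E G (σ (fromℕ m)) (σ fzero)

-- Number the rim positions cyclically and call a position a a switch when
-- rim a is adjacent to hub₀ and rim (a + 1) to hub₁.  Since G − {hub₀, hub₁} is
-- connected, at most one rim edge is missing; since every vertex keeps a neighbour after
-- deleting any two others, every rim vertex sees a hub and both ends of a missing rim
-- edge see both hubs.  Walking along the rim from a neighbour of hub₀ to a neighbour of
-- hub₁ yields a switch.  A Hamiltonian cycle is then made of at most two rim arcs joined
-- through the hubs, using a switch together with either the hub edge, a second switch,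
-- or, failing both, a pair of rim gaps whose ends see hub₁ and hub₀ respectively; a short
-- case analysis on the further hub neighbours supplied by 3-connectivity always finds one
-- of these configurations.
module Submission where

open import Data.Empty using (⊥)
open import Data.Fin using (Fin; toℕ; inject₁; fromℕ; punchIn; punchOut) renaming (zero to fzero; suc to fsuc)
import Data.Fin as Fin
open import Data.Fin.Properties using (_≟_; punchIn-punchOut; injective⇒≤; toℕ-injective; toℕ-fromℕ<; toℕ<n)
  renaming (suc-injective to fsuc-injective)
open import Data.List using (List; []; _∷_; _++_; _∷ʳ_; length; lookup; reverse)
open import Data.List.Membership.Propositional using (_∈_)
open import Data.List.Membership.Propositional.Properties using (∈-++⁺ˡ; ∈-++⁺ʳ; ∈-++⁻)
open import Data.List.Properties using (unfold-reverse; length-++; length-reverse)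
open import Data.List.Relation.Unary.Any using (here; there; index)
open import Data.List.Relation.Unary.Any.Properties using (lookup-index; reverse⁺)
open import Data.List.Relation.Unary.Linked using (Linked; [-]; _∷_)
open import Data.Nat using (ℕ; zero; suc; _+_; _∸_; _≤_; _<_; z≤n; s≤s; _%_; _<?_; _≤?_; NonZero)
open import Data.Nat.DivMod using (_mod_; %-distribˡ-+; m%n%n≡m%n; [m+n]%n≡m%n; m<n⇒m%n≡m; m%n<n; n%n≡0)
open import Data.Nat.Properties
  using ( +-comm; +-assoc; +-identityʳ; +-suc; m+[n∸m]≡n; suc-injective; 1+n≰n; n≮0
        ; ≤-refl; ≤-reflexive; ≤-trans; ≤-antisym; ≤-pred; ≮⇒≥; <⇒≤; <⇒≢; <-irrefl; <-trans
        ; ≤-<-trans; <-≤-trans; <-cmp; n≤1+n; n<1+n; m≤m+n; m<m+n; m<n⇒m<1+n; +-monoʳ-< )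
open import Data.Product using (Σ; ∃; ∃₂; _×_; _,_; proj₁; proj₂)
open import Data.Sum using (_⊎_; inj₁; inj₂; map; map₂; swap)
open import Function.Definitions using (Injective; StrictlySurjective)
open import Relation.Binary.Definitions using (tri<; tri≈; tri>)
open import Relation.Binary.PropositionalEquality
open import Relation.Nullary using (¬_; yes; no; contradiction)
open import Relation.Nullary.Decidable using (_×-dec_)
open import Relation.Unary using (Decidable)

open import Defs renaming (sym to E-sym)

open ≡-Reasoning

-- If f a ≡ f b with a ≢ b, then f ∘ punchIn b is still onto, and a section of it
-- would inject Fin (suc m) into Fin m.
strictlySurjective⇒injective : ∀ {m} (f : Fin m → Fin m) → StrictlySurjective _≡_ f → Injective _≡_ _≡_ f
strictlySurjective⇒injective {suc m} f surj {a} {b} fa≡fb with a ≟ b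
... | yes a≡b = a≡b
... | no a≢b = contradiction (injective⇒≤ section-injective) 1+n≰n
  where
  preimage-avoiding-b : ∀ y → ∃ λ x → b ≢ x × f x ≡ y
  preimage-avoiding-b y with surj y
  ... | x , fx≡y with b ≟ x
  ...   | no b≢x = x , b≢x , fx≡y
  ...   | yes refl = a , (λ b≡a → a≢b (sym b≡a)) , trans fa≡fb fx≡y

  section : Fin (suc m) → Fin m
  section y = punchOut (proj₁ (proj₂ (preimage-avoiding-b y)))

  f-punchIn-section : ∀ y → f (punchIn b (section y)) ≡ y
  f-punchIn-section y = trans (cong f (punchIn-punchOut _)) (proj₂ (proj₂ (preimage-avoiding-b y)))

  section-injective : Injective _≡_ _≡_ section
  section-injective {y} {y'} eq =
    trans (sym (f-punchIn-section y)) (trans (cong (λ x → f (punchIn b x)) eq) (f-punchIn-section y'))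

module _ {A : Set} {R : A → A → Set} where

  linked⇒lookup-consecutive : ∀ {x xs y} → Linked R (x ∷ xs ∷ʳ y) →
                              ∀ i → R (lookup (x ∷ xs) (inject₁ i)) (lookup xs i)
  linked⇒lookup-consecutive {xs = _ ∷ _} (r ∷ _)  fzero    = r
  linked⇒lookup-consecutive {xs = _ ∷ _} (_ ∷ rs) (fsuc i) = linked⇒lookup-consecutive rs i

  linked⇒lookup-last : ∀ {x xs y} → Linked R (x ∷ xs ∷ʳ y) → R (lookup (x ∷ xs) (fromℕ (length xs))) y
  linked⇒lookup-last {xs = []}    (r ∷ _)  = r
  linked⇒lookup-last {xs = _ ∷ _} (_ ∷ rs) = linked⇒lookup-last rs

  lookup-cycle : ∀ {m x xs} → length xs ≡ m → Linked R (x ∷ xs ∷ʳ x) →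
                 Σ (Fin (suc m) → A) λ σ →
                   (∀ v → v ∈ x ∷ xs → ∃ λ i → σ i ≡ v) ×
                   (∀ i → R (σ (inject₁ i)) (σ (fsuc i))) × R (σ (fromℕ m)) (σ fzero)
  lookup-cycle {x = x} {xs} refl walk =
    lookup (x ∷ xs) , (λ v v∈ → index v∈ , sym (lookup-index v∈)) ,
    linked⇒lookup-consecutive walk , linked⇒lookup-last walk

pairwise-⊎⇒all-but-one : ∀ {m} (P : Fin (suc m) → Set) → (∀ i j → i ≢ j → P i ⊎ P j) →
                         ∃ λ c → ∀ p → p ≢ c → P p
pairwise-⊎⇒all-but-one {zero}  P _ = fzero , λ { fzero 0≢0 → contradiction refl 0≢0 }
pairwise-⊎⇒all-but-one {suc m} P pairwise
  with pairwise-⊎⇒all-but-one (λ p → P (fsuc p)) (λ i j i≢j → pairwise (fsuc i) (fsuc j) (λ eq → i≢j (fsuc-injective eq)))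
... | c , P-off-c with pairwise fzero (fsuc c) (λ ())
...   | inj₁ P0 = fsuc c , λ { fzero _ → P0 ; (fsuc p) p≢c → P-off-c p (λ eq → p≢c (cong fsuc eq)) }
...   | inj₂ Pc = fzero , P-off-0
  where
  P-off-0 : ∀ p → p ≢ fzero → P p
  P-off-0 fzero    0≢0 = contradiction refl 0≢0
  P-off-0 (fsuc p) _ with p ≟ c
  ... | yes refl = Pc
  ... | no p≢c   = P-off-c p p≢c

first-crossing : ∀ {A B : ℕ → Set} → (∀ j → A j ⊎ B j) → A 0 → ∀ L → B (suc L) →
                 ∃ λ j → j ≤ L × A j × B (suc j)
first-crossing         A⊎B a₀ zero    b₁ = 0 , z≤n , a₀ , b₁
first-crossing {A} {B} A⊎B a₀ (suc L) b with A⊎B 1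
... | inj₂ b₁ = 0 , z≤n , a₀ , b₁
... | inj₁ a₁ with first-crossing {λ j → A (suc j)} {λ j → B (suc j)} (λ j → A⊎B (suc j)) a₁ L b
...   | j , j≤L , aj , bj = suc j , s≤s j≤L , aj , bj

Path : ∀ {n} → Graph n → Fin n → List (Fin n) → Fin n → Set
Path G x vs y = Linked (E G) (x ∷ vs ∷ʳ y)

module _ {n} (G : Graph n) where

  path-++ : ∀ {x y z} us {vs} → Path G x us y → Path G y vs z → Path G x (us ++ y ∷ vs) z
  path-++ []       (xy ∷ _) p = xy ∷ p
  path-++ (_ ∷ us) (xu ∷ p) q = xu ∷ path-++ us p q

  path-reverse : ∀ {x y} vs → Path G x vs y → Path G y (reverse vs) x
  path-reverse []       (xy ∷ _) = E-sym G xy ∷ [-]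
  path-reverse (v ∷ vs) (xv ∷ p) rewrite unfold-reverse v vs =
    path-++ (reverse vs) (path-reverse vs p) (E-sym G xv ∷ [-])

  reach-source : ∀ {P u v} → Reach G P u v → P u
  reach-source (here pu)     = pu
  reach-source (step pu _ _) = pu

  reach-exit : ∀ {P S : Fin n → Set} {u v} → Decidable S → Reach G P u v → S u → ¬ S v →
               ∃₂ λ w w' → S w × ¬ S w' × P w' × E G w w'
  reach-exit S? (here _) su ¬sv = contradiction su ¬sv
  reach-exit S? (step {w = w} _ uw r) su ¬sv with S? w
  ... | yes sw = reach-exit S? r sw ¬sv
  ... | no ¬sw = _ , w , su , ¬sw , reach-source r , uw

  -- The first step of a walk from v to t in G − {x, y}.
  neighbour-avoiding : (∀ x y → ConnectedAvoiding G x y) →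
                       ∀ {v t x y} → v ≢ t → v ≢ x → v ≢ y → t ≢ x → t ≢ y →
                       ∃ λ w → E G v w × w ≢ x × w ≢ y
  neighbour-avoiding conn {v} {t} {x} {y} v≢t v≢x v≢y t≢x t≢y with conn x y v t v≢x v≢y t≢x t≢y
  ... | here _         = contradiction refl v≢t
  ... | step _ vw walk = _ , vw , reach-source walk

closed-walk⇒hamiltonian : ∀ {m} (G : Graph (suc m)) x xs → length xs ≡ m →
                          (∀ v → v ∈ x ∷ xs) → Path G x xs x → Hamiltonian G
closed-walk⇒hamiltonian G x xs len covers walk with lookup-cycle len walk
... | σ , onto , consecutive , last =
  σ , strictlySurjective⇒injective σ (λ v → onto v (covers v)) , consecutive , last

module CyclicPositions (M : ℕ) {{_ : NonZero M}} where

  infixl 6 _⊕_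

  -- Kept opaque: nothing later computes with positions or with these proofs, and
  -- unfolding them makes with-abstraction over terms that mention them very slow.
  opaque
    _⊕_ : Fin M → ℕ → Fin M
    p ⊕ i = (toℕ p + i) mod M

    toℕ-⊕ : ∀ p i → toℕ (p ⊕ i) ≡ (toℕ p + i) % M
    toℕ-⊕ p i = toℕ-fromℕ< _

  next : Fin M → Fin M
  next p = p ⊕ 1

  offset : Fin M → Fin M → ℕ
  offset p q = (toℕ q + (M ∸ toℕ p)) % M

  opaque
    private
      [x%M+y]%M : ∀ x y → (x % M + y) % M ≡ (x + y) % M
      [x%M+y]%M x y = begin
        (x % M + y) % M             ≡⟨ %-distribˡ-+ (x % M) y M ⟩
        (x % M % M + y % M) % M     ≡⟨ cong (λ t → (t + y % M) % M) (m%n%n≡m%n x M) ⟩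
        (x % M + y % M) % M         ≡⟨ %-distribˡ-+ x y M ⟨
        (x + y) % M                 ∎

      [x+y%M]%M : ∀ x y → (x + y % M) % M ≡ (x + y) % M
      [x+y%M]%M x y = begin
        (x + y % M) % M  ≡⟨ cong (_% M) (+-comm x (y % M)) ⟩
        (y % M + x) % M  ≡⟨ [x%M+y]%M y x ⟩
        (y + x) % M      ≡⟨ cong (_% M) (+-comm y x) ⟩
        (x + y) % M      ∎

      [i+M]%M : ∀ {i} → i < M → (i + M) % M ≡ i
      [i+M]%M i<M = trans ([m+n]%n≡m%n _ M) (m<n⇒m%n≡m i<M)

      p+[q+[M∸p]]≡q+M : ∀ (p : Fin M) q → toℕ p + (q + (M ∸ toℕ p)) ≡ q + M
      p+[q+[M∸p]]≡q+M p q = begin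
        toℕ p + (q + (M ∸ toℕ p))  ≡⟨ +-assoc (toℕ p) q _ ⟨
        toℕ p + q + (M ∸ toℕ p)    ≡⟨ cong (_+ (M ∸ toℕ p)) (+-comm (toℕ p) q) ⟩
        q + toℕ p + (M ∸ toℕ p)    ≡⟨ +-assoc q (toℕ p) _ ⟩
        q + (toℕ p + (M ∸ toℕ p))  ≡⟨ cong (q +_) (m+[n∸m]≡n (<⇒≤ (toℕ<n p))) ⟩
        q + M                      ∎

    ⊕-identityʳ : ∀ p → p ⊕ 0 ≡ p
    ⊕-identityʳ p = toℕ-injective (begin
      toℕ (p ⊕ 0)        ≡⟨ toℕ-⊕ p 0 ⟩
      (toℕ p + 0) % M    ≡⟨ cong (_% M) (+-identityʳ (toℕ p)) ⟩
      toℕ p % M          ≡⟨ m<n⇒m%n≡m (toℕ<n p) ⟩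
      toℕ p              ∎)

    ⊕-assoc : ∀ p i j → p ⊕ i ⊕ j ≡ p ⊕ (i + j)
    ⊕-assoc p i j = toℕ-injective (begin
      toℕ (p ⊕ i ⊕ j)              ≡⟨ toℕ-⊕ (p ⊕ i) j ⟩
      (toℕ (p ⊕ i) + j) % M        ≡⟨ cong (λ t → (t + j) % M) (toℕ-⊕ p i) ⟩
      ((toℕ p + i) % M + j) % M    ≡⟨ [x%M+y]%M (toℕ p + i) j ⟩
      (toℕ p + i + j) % M          ≡⟨ cong (_% M) (+-assoc (toℕ p) i j) ⟩
      (toℕ p + (i + j)) % M        ≡⟨ toℕ-⊕ p (i + j) ⟨
      toℕ (p ⊕ (i + j))            ∎)

    ⊕-period : ∀ p → p ⊕ M ≡ p
    ⊕-period p = toℕ-injective (trans (toℕ-⊕ p M) ([i+M]%M (toℕ<n p)))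

    offset<M : ∀ p q → offset p q < M
    offset<M p q = m%n<n _ M

    ⊕-offset : ∀ p q → p ⊕ offset p q ≡ q
    ⊕-offset p q = toℕ-injective (begin
      toℕ (p ⊕ offset p q)                         ≡⟨ toℕ-⊕ p (offset p q) ⟩
      (toℕ p + (toℕ q + (M ∸ toℕ p)) % M) % M      ≡⟨ [x+y%M]%M (toℕ p) _ ⟩
      (toℕ p + (toℕ q + (M ∸ toℕ p))) % M          ≡⟨ cong (_% M) (p+[q+[M∸p]]≡q+M p (toℕ q)) ⟩
      (toℕ q + M) % M                              ≡⟨ [i+M]%M (toℕ<n q) ⟩
      toℕ q                                        ∎)

    offset-⊕ : ∀ p {i} → i < M → offset p (p ⊕ i) ≡ i
    offset-⊕ p {i} i<M = begin
      (toℕ (p ⊕ i) + (M ∸ toℕ p)) % M              ≡⟨ cong (λ t → (t + (M ∸ toℕ p)) % M) (toℕ-⊕ p i) ⟩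
      ((toℕ p + i) % M + (M ∸ toℕ p)) % M          ≡⟨ [x%M+y]%M (toℕ p + i) _ ⟩
      (toℕ p + i + (M ∸ toℕ p)) % M                ≡⟨ cong (_% M) (+-assoc (toℕ p) i _) ⟩
      (toℕ p + (i + (M ∸ toℕ p))) % M              ≡⟨ cong (_% M) (p+[q+[M∸p]]≡q+M p i) ⟩
      (i + M) % M                                  ≡⟨ [i+M]%M i<M ⟩
      i                                            ∎

    ⊕-injective : ∀ p {i j} → i < M → j < M → p ⊕ i ≡ p ⊕ j → i ≡ j
    ⊕-injective p {i} {j} i<M j<M eq =
      trans (sym (offset-⊕ p i<M)) (trans (cong (offset p) eq) (offset-⊕ p j<M))

    toℕ-next : ∀ p → toℕ (next p) ≡ suc (toℕ p) % M
    toℕ-next p = trans (toℕ-⊕ p 1) (cong (_% M) (+-comm (toℕ p) 1))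

    toℕ-next-cases : ∀ p → suc (toℕ p) < M × toℕ (next p) ≡ suc (toℕ p) ⊎ suc (toℕ p) ≡ M × toℕ (next p) ≡ 0
    toℕ-next-cases p with suc (toℕ p) <? M
    ... | yes 1+p<M = inj₁ (1+p<M , trans (toℕ-next p) (m<n⇒m%n≡m 1+p<M))
    ... | no 1+p≮M  = inj₂ (1+p≡M , trans (toℕ-next p) (trans (cong (_% M) 1+p≡M) (n%n≡0 M)))
      where
      1+p≡M : suc (toℕ p) ≡ M
      1+p≡M = ≤-antisym (toℕ<n p) (≮⇒≥ 1+p≮M)

    ⊕-suc : ∀ p i → p ⊕ suc i ≡ next (p ⊕ i)
    ⊕-suc p i = trans (cong (p ⊕_) (+-comm 1 i)) (sym (⊕-assoc p i 1))

    ⊕-≢ : ∀ p {i j} → i < M → j < M → i ≢ j → p ⊕ i ≢ p ⊕ j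
    ⊕-≢ p i<M j<M i≢j eq = i≢j (⊕-injective p i<M j<M eq)

    ⊕-≢-self : ∀ p {i} → 0 < i → i < M → p ⊕ i ≢ p
    ⊕-≢-self p {i} 0<i i<M eq = ⊕-≢ p i<M 0<M (λ i≡0 → <⇒≢ 0<i (sym i≡0)) (trans eq (sym (⊕-identityʳ p)))
      where
      0<M : 0 < M
      0<M = ≤-<-trans z≤n i<M

    split-offset : ∀ p q → p ≢ q → ∃₂ λ L₁ L₂ → suc L₁ + suc L₂ ≡ M × p ⊕ suc L₁ ≡ q
    split-offset p q p≢q with offset p q | offset<M p q | ⊕-offset p q
    ... | zero   | _     | p⊕0≡q = contradiction (trans (sym (⊕-identityʳ p)) p⊕0≡q) p≢q
    ... | suc L₁ | d<M   | p⊕d≡q = L₁ , M ∸ suc (suc L₁) ,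
          trans (+-suc (suc L₁) _) (m+[n∸m]≡n d<M) , p⊕d≡q

-- The numbering of Defs: the hubs are 0 and 1, rim position p is vertex p + 2.
pattern hub₀  = fzero
pattern hub₁  = fsuc fzero
pattern rim p = fsuc (fsuc p)

module Wheel (k : ℕ) where

  M : ℕ
  M = suc (suc (suc k))

  open CyclicPositions M public

  n : ℕ
  n = suc (suc M)

  prev : Fin M → Fin M
  prev p = p ⊕ suc (suc k)

  prev-next : ∀ p → prev (next p) ≡ p
  prev-next p = trans (⊕-assoc p 1 (suc (suc k))) (⊕-period p)

  next-prev : ∀ p → next (prev p) ≡ p
  next-prev p = trans (⊕-assoc p (suc (suc k)) 1) (trans (cong (p ⊕_) (+-comm (suc (suc k)) 1)) (⊕-period p))

  next≢self : ∀ p → next p ≢ p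
  next≢self p = ⊕-≢-self p (s≤s z≤n) (s≤s (s≤s z≤n))

  prev≢self : ∀ p → prev p ≢ p
  prev≢self p = ⊕-≢-self p (s≤s z≤n) ≤-refl

  rim-injective : ∀ {p q : Fin M} → _≡_ {A = Fin n} (rim p) (rim q) → p ≡ q
  rim-injective refl = refl

  rim-≢ : ∀ {p q : Fin M} → p ≢ q → _≢_ {A = Fin n} (rim p) (rim q)
  rim-≢ p≢q eq = p≢q (rim-injective eq)

  ≢-prev : ∀ {i z} → z ≢ next i → i ≢ prev z
  ≢-prev {i} {z} z≢i⁺ i≡z⁻ = z≢i⁺ (trans (sym (next-prev z)) (cong next (sym i≡z⁻)))

  data HubPair : Fin n → Fin n → Set where
    hubs₀₁ : HubPair hub₀ hub₁
    hubs₁₀ : HubPair hub₁ hub₀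

  hubPair-swap : ∀ {h h̄} → HubPair h h̄ → HubPair h̄ h
  hubPair-swap hubs₀₁ = hubs₁₀
  hubPair-swap hubs₁₀ = hubs₀₁

  hubPair-distinct : ∀ {h h̄} → HubPair h h̄ → h ≢ h̄
  hubPair-distinct hubs₀₁ ()
  hubPair-distinct hubs₁₀ ()

  rim≢hub : ∀ {h h̄ p} → HubPair h h̄ → rim p ≢ h
  rim≢hub hubs₀₁ ()
  rim≢hub hubs₁₀ ()

  vertex-cases : ∀ {h h̄} → HubPair h h̄ → ∀ v → v ≡ h ⊎ v ≡ h̄ ⊎ ∃ λ p → v ≡ rim p
  vertex-cases hubs₀₁ hub₀    = inj₁ refl
  vertex-cases hubs₀₁ hub₁    = inj₂ (inj₁ refl)
  vertex-cases hubs₁₀ hub₀    = inj₂ (inj₁ refl)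
  vertex-cases hubs₁₀ hub₁    = inj₁ refl
  vertex-cases _      (rim p) = inj₂ (inj₂ (p , refl))

  bicycle-rim : ∀ p → BEdge n (rim p) (rim (next p))
  bicycle-rim p with toℕ-next-cases p
  ... | inj₁ (_ , p⁺≡1+p)   = subst (λ t → BEdgeℕ n (2 + toℕ p) (2 + t)) (sym p⁺≡1+p) (rimˡ (s≤s (s≤s z≤n)))
  ... | inj₂ (1+p≡M , p⁺≡0) = subst (λ t → BEdgeℕ n (2 + toℕ p) (2 + t)) (sym p⁺≡0) (closeʳ (cong (2 +_) 1+p≡M))

  -- Stated for ℕ indices, where the constructors of BEdgeℕ can be matched against.
  private
    rim-edgeℕ⁻ : ∀ {x y} → x < M → y < M → BEdgeℕ n (2 + x) (2 + y) → y ≡ suc x % M ⊎ x ≡ suc y % M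
    rim-edgeℕ⁻ _   _   (spokeˡ (s≤s ()) _)
    rim-edgeℕ⁻ _   _   (spokeʳ (s≤s ()) _)
    rim-edgeℕ⁻ _   y<M (rimˡ _)       = inj₁ (sym (m<n⇒m%n≡m y<M))
    rim-edgeℕ⁻ x<M _   (rimʳ _)       = inj₂ (sym (m<n⇒m%n≡m x<M))
    rim-edgeℕ⁻ _   _   (closeˡ 3+y≡n) = inj₂ (sym (trans (cong (_% M) (suc-injective (suc-injective 3+y≡n))) (n%n≡0 M)))
    rim-edgeℕ⁻ _   _   (closeʳ 3+x≡n) = inj₁ (sym (trans (cong (_% M) (suc-injective (suc-injective 3+x≡n))) (n%n≡0 M)))

  bicycle-rim⁻ : ∀ {p q} → BEdge n (rim p) (rim q) → q ≡ next p ⊎ p ≡ next q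
  bicycle-rim⁻ {p} {q} e with rim-edgeℕ⁻ (toℕ<n p) (toℕ<n q) e
  ... | inj₁ q≡1+p = inj₁ (toℕ-injective (trans q≡1+p (sym (toℕ-next p))))
  ... | inj₂ p≡1+q = inj₂ (toℕ-injective (trans p≡1+q (sym (toℕ-next q))))

module OnWheel (k : ℕ) (G : Graph (suc (suc (suc (suc (suc k)))))) where

  open Wheel k public

  RimEdge : Fin M → Set
  RimEdge p = E G (rim p) (rim (next p))

  RimEdgesExcept : Fin M → Fin M → Set
  RimEdgesExcept a b = ∀ p → p ≢ a → p ≢ b → RimEdge p

  Switch : Fin M → Set
  Switch a = E G (rim a) hub₀ × E G (rim (next a)) hub₁

  Bridge : Fin n → Fin M → Set
  Bridge h a = E G (rim a) h × E G (rim (next a)) h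

  arc : Fin M → ℕ → ℕ → List (Fin n)
  arc a o zero    = []
  arc a o (suc L) = rim (a ⊕ o) ∷ arc a (suc o) L

  length-arc : ∀ a o L → length (arc a o L) ≡ L
  length-arc a o zero    = refl
  length-arc a o (suc L) = cong suc (length-arc a (suc o) L)

  arc-++ : ∀ a o L L' → arc a o (L + L') ≡ arc a o L ++ arc a (o + L) L'
  arc-++ a o zero    L' = cong (λ t → arc a t L') (sym (+-identityʳ o))
  arc-++ a o (suc L) L' = cong (rim (a ⊕ o) ∷_) (begin
    arc a (suc o) (L + L')                         ≡⟨ arc-++ a (suc o) L L' ⟩
    arc a (suc o) L ++ arc a (suc o + L) L'        ≡⟨ cong (λ t → arc a (suc o) L ++ arc a t L') (+-suc o L) ⟨
    arc a (suc o) L ++ arc a (o + suc L) L'        ∎)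

  ∈-arc : ∀ a o {L j} → j < L → rim (a ⊕ (o + j)) ∈ arc a o L
  ∈-arc a o {suc L} {zero}  _         = here (cong (λ t → rim (a ⊕ t)) (+-identityʳ o))
  ∈-arc a o {suc L} {suc j} (s≤s j<L) =
    there (subst (λ t → rim (a ⊕ t) ∈ arc a (suc o) L) (sym (+-suc o j)) (∈-arc a (suc o) j<L))

  arc-covers : ∀ a p → rim p ∈ arc a 1 M
  arc-covers a p with offset a p | offset<M a p | ⊕-offset a p
  ... | zero  | _     | a⊕0≡p   =
    subst (λ t → rim t ∈ arc a 1 M) (trans (⊕-period a) (trans (sym (⊕-identityʳ a)) a⊕0≡p)) (∈-arc a 1 ≤-refl)
  ... | suc j | 1+j<M | a⊕1+j≡p =
    subst (λ t → rim t ∈ arc a 1 M) a⊕1+j≡p (∈-arc a 1 (<-trans (n<1+n j) 1+j<M))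

  rim-edge-⊕ : ∀ a i → RimEdge (a ⊕ i) → E G (rim (a ⊕ i)) (rim (a ⊕ suc i))
  rim-edge-⊕ a i = subst (λ t → E G (rim (a ⊕ i)) (rim t)) (sym (⊕-suc a i))

  arc-path : ∀ {x y} a o L → E G x (rim (a ⊕ o)) → (∀ j → j < L → RimEdge (a ⊕ (o + j))) →
             E G (rim (a ⊕ (o + L))) y → Path G x (arc a o (suc L)) y
  arc-path {y = y} a o zero    x∼ _     ∼y = x∼ ∷ subst (λ t → E G (rim (a ⊕ t)) y) (+-identityʳ o) ∼y ∷ [-]
  arc-path {y = y} a o (suc L) x∼ edges ∼y =
    x∼ ∷ arc-path a (suc o) L first
           (λ j j<L → subst (λ t → RimEdge (a ⊕ t)) (+-suc o j) (edges (suc j) (s≤s j<L)))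
           (subst (λ t → E G (rim (a ⊕ t)) y) (+-suc o L) ∼y)
    where
    first : E G (rim (a ⊕ o)) (rim (a ⊕ suc o))
    first = rim-edge-⊕ a o (subst (λ t → RimEdge (a ⊕ t)) (+-identityʳ o) (edges 0 (s≤s z≤n)))

  hub-cycle⇒hamiltonian : ∀ {A B} → Path G hub₁ A hub₀ → Path G hub₀ B hub₁ →
                          (∀ p → rim p ∈ A ⊎ rim p ∈ B) → length A + length B ≡ M → Hamiltonian G
  hub-cycle⇒hamiltonian {A} {B} pathA pathB covers lengths =
    closed-walk⇒hamiltonian G hub₁ (A ++ hub₀ ∷ B) length-cycle covers-cycle (path-++ G A pathA pathB)
    where
    length-cycle : length (A ++ hub₀ ∷ B) ≡ suc M
    length-cycle = trans (length-++ A) (trans (+-suc (length A) (length B)) (cong suc lengths))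
    covers-cycle : ∀ v → v ∈ hub₁ ∷ A ++ hub₀ ∷ B
    covers-cycle hub₀    = there (∈-++⁺ʳ A (here refl))
    covers-cycle hub₁    = here refl
    covers-cycle (rim p) with covers p
    ... | inj₁ ∈A = there (∈-++⁺ˡ ∈A)
    ... | inj₂ ∈B = there (∈-++⁺ʳ A (there ∈B))

  -- The cycle hub₁, a+1, …, a, hub₀.
  switch+hub-edge⇒hamiltonian : ∀ a → Switch a → E G hub₀ hub₁ → RimEdgesExcept a a → Hamiltonian G
  switch+hub-edge⇒hamiltonian a (a∼h₀ , a⁺∼h₁) h₀∼h₁ rim-ok =
    hub-cycle⇒hamiltonian {B = []}
      (arc-path a 1 (suc (suc k)) (E-sym G a⁺∼h₁) edges (subst (λ t → E G (rim t) hub₀) (sym (⊕-period a)) a∼h₀))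
      (h₀∼h₁ ∷ [-]) (λ p → inj₁ (arc-covers a p)) (trans (+-identityʳ _) (length-arc a 1 M))
    where
    edges : ∀ j → j < suc (suc k) → RimEdge (a ⊕ suc j)
    edges j j<2+k = rim-ok _ a⊕1+j≢a a⊕1+j≢a
      where
      a⊕1+j≢a : a ⊕ suc j ≢ a
      a⊕1+j≢a = ⊕-≢-self a (s≤s z≤n) (s≤s j<2+k)

  -- Cutting the rim at a and b = a ⊕ suc L₁ leaves the arcs a+1, …, b and b+1, …, a.
  module TwoArcs (a : Fin M) (L₁ L₂ : ℕ) (M≡ : suc L₁ + suc L₂ ≡ M)
                 (rim-ok : RimEdgesExcept a (a ⊕ suc L₁)) where

    first second : List (Fin n)
    first  = arc a 1 (suc L₁)
    second = arc a (2 + L₁) (suc L₂)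

    private
      1+L₁<M : suc L₁ < M
      1+L₁<M = subst (suc L₁ <_) M≡ (m<m+n (suc L₁) (s≤s z≤n))

      2+L₁+L₂≡M : 2 + L₁ + L₂ ≡ M
      2+L₁+L₂≡M = trans (sym (+-suc (suc L₁) L₂)) M≡

      inner-edge : ∀ i → 0 < i → i < M → i ≢ suc L₁ → RimEdge (a ⊕ i)
      inner-edge i 0<i i<M i≢1+L₁ = rim-ok _ (⊕-≢-self a 0<i i<M) (⊕-≢ a i<M 1+L₁<M i≢1+L₁)

    first-path : ∀ {x y} → E G x (rim (next a)) → E G (rim (a ⊕ suc L₁)) y → Path G x first y
    first-path x∼ ∼y = arc-path a 1 L₁ x∼ edges ∼y
      where
      edges : ∀ j → j < L₁ → RimEdge (a ⊕ suc j)
      edges j j<L₁ = inner-edge (suc j) (s≤s z≤n) (<-trans (s≤s j<L₁) 1+L₁<M) (λ eq → <⇒≢ j<L₁ (suc-injective eq))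

    second-path : ∀ {x y} → E G x (rim (next (a ⊕ suc L₁))) → E G (rim a) y → Path G x second y
    second-path {x} {y} x∼ ∼y =
      arc-path a (2 + L₁) L₂ (subst (λ t → E G x (rim t)) (sym (⊕-suc a (suc L₁))) x∼) edges
        (subst (λ t → E G (rim t) y) (sym (trans (cong (a ⊕_) 2+L₁+L₂≡M) (⊕-period a))) ∼y)
      where
      edges : ∀ j → j < L₂ → RimEdge (a ⊕ (2 + L₁ + j))
      edges j j<L₂ = inner-edge (2 + L₁ + j) (s≤s z≤n) (<-≤-trans (+-monoʳ-< (2 + L₁) j<L₂) (≤-reflexive 2+L₁+L₂≡M))
                       (λ eq → <⇒≢ (s≤s (m≤m+n (suc L₁) j)) (sym eq))

    covers : ∀ p → rim p ∈ first ⊎ rim p ∈ second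
    covers p = ∈-++⁻ first (subst (rim p ∈_) (trans (cong (arc a 1) (sym M≡)) (arc-++ a 1 (suc L₁) (suc L₂))) (arc-covers a p))

    lengths : length first + length second ≡ M
    lengths = trans (cong₂ _+_ (length-arc a 1 (suc L₁)) (length-arc a (2 + L₁) (suc L₂))) M≡

  -- The cycle hub₁, a+1, …, b, hub₀, a, a−1, …, b+1.
  two-switches⇒hamiltonian : ∀ a b → a ≢ b → Switch a → Switch b → RimEdgesExcept a b → Hamiltonian G
  two-switches⇒hamiltonian a b a≢b (a∼h₀ , a⁺∼h₁) (b∼h₀ , b⁺∼h₁) rim-ok with split-offset a b a≢b
  ... | L₁ , L₂ , M≡ , refl =
    hub-cycle⇒hamiltonian (first-path (E-sym G a⁺∼h₁) b∼h₀)
      (path-reverse G second (second-path (E-sym G b⁺∼h₁) a∼h₀))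
      (λ p → map₂ reverse⁺ (covers p))
      (trans (cong (length first +_) (length-reverse second)) lengths)
    where open TwoArcs a L₁ L₂ M≡ rim-ok

  -- The cycle hub₁, a+1, …, b, hub₀, b+1, …, a.
  opposite-bridges⇒hamiltonian : ∀ a b → a ≢ b → Bridge hub₁ a → Bridge hub₀ b → RimEdgesExcept a b → Hamiltonian G
  opposite-bridges⇒hamiltonian a b a≢b (a∼h₁ , a⁺∼h₁) (b∼h₀ , b⁺∼h₀) rim-ok with split-offset a b a≢b
  ... | L₁ , L₂ , M≡ , refl =
    hub-cycle⇒hamiltonian (first-path (E-sym G a⁺∼h₁) b∼h₀) (second-path (E-sym G b⁺∼h₀) a∼h₁) covers lengths
    where open TwoArcs a L₁ L₂ M≡ rim-ok

module ThreeConnectedSubgraph (k : ℕ) (G : Graph (suc (suc (suc (suc (suc k))))))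
                              (sub : SubgraphOfBicycle G) (conn : ∀ x y → ConnectedAvoiding G x y) where

  open OnWheel k G

  rim-neighbour : ∀ {h h̄ p w} → HubPair h h̄ → E G (rim p) w →
                  w ≡ h ⊎ w ≡ h̄ ⊎ w ≡ rim (next p) ⊎ w ≡ rim (prev p)
  rim-neighbour {w = w} hp e with vertex-cases hp w
  ... | inj₁ w≡h                = inj₁ w≡h
  ... | inj₂ (inj₁ w≡h̄)         = inj₂ (inj₁ w≡h̄)
  ... | inj₂ (inj₂ (q , refl)) with bicycle-rim⁻ (sub _ _ e)
  ...   | inj₁ q≡p⁺ = inj₂ (inj₂ (inj₁ (cong rim q≡p⁺)))
  ...   | inj₂ p≡q⁺ = inj₂ (inj₂ (inj₂ (cong rim (trans (sym (prev-next q)) (cong prev (sym p≡q⁺))))))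

  spoke : ∀ p → E G (rim p) hub₀ ⊎ E G (rim p) hub₁
  spoke p with neighbour-avoiding G conn {rim p} {hub₀} {rim (next p)} {rim (prev p)}
                 (λ ()) (rim-≢ (≢-sym (next≢self p))) (rim-≢ (≢-sym (prev≢self p))) (λ ()) (λ ())
  ... | w , e , w≢p⁺ , w≢p⁻ with rim-neighbour hubs₀₁ e
  ... | inj₁ refl                = inj₁ e
  ... | inj₂ (inj₁ refl)         = inj₂ e
  ... | inj₂ (inj₂ (inj₁ w≡p⁺)) = contradiction w≡p⁺ w≢p⁺
  ... | inj₂ (inj₂ (inj₂ w≡p⁻)) = contradiction w≡p⁻ w≢p⁻

  gap-start-spoke : ∀ {h h̄} → HubPair h h̄ → ∀ c → E G (rim c) h ⊎ RimEdge c
  gap-start-spoke {h} {h̄} hp c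
    with neighbour-avoiding G conn {rim c} {h} {rim (prev c)} {h̄}
           (rim≢hub hp) (rim-≢ (≢-sym (prev≢self c))) (rim≢hub (hubPair-swap hp))
           (λ h≡ → rim≢hub hp (sym h≡)) (hubPair-distinct hp)
  ... | w , e , w≢c⁻ , w≢h̄ with rim-neighbour hp e
  ... | inj₁ refl                = inj₁ e
  ... | inj₂ (inj₁ w≡h̄)         = contradiction w≡h̄ w≢h̄
  ... | inj₂ (inj₂ (inj₁ refl))  = inj₂ e
  ... | inj₂ (inj₂ (inj₂ w≡c⁻)) = contradiction w≡c⁻ w≢c⁻

  gap-end-spoke : ∀ {h h̄} → HubPair h h̄ → ∀ c → E G (rim (next c)) h ⊎ RimEdge c
  gap-end-spoke {h} {h̄} hp c
    with neighbour-avoiding G conn {rim (next c)} {h} {rim (next (next c))} {h̄}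
           (rim≢hub hp) (rim-≢ (≢-sym (next≢self (next c)))) (rim≢hub (hubPair-swap hp))
           (λ h≡ → rim≢hub hp (sym h≡)) (hubPair-distinct hp)
  ... | w , e , w≢c⁺⁺ , w≢h̄ with rim-neighbour hp e
  ... | inj₁ refl                 = inj₁ e
  ... | inj₂ (inj₁ w≡h̄)          = contradiction w≡h̄ w≢h̄
  ... | inj₂ (inj₂ (inj₁ w≡c⁺⁺)) = contradiction w≡c⁺⁺ w≢c⁺⁺
  ... | inj₂ (inj₂ (inj₂ refl))   = inj₂ (subst (λ t → E G (rim t) (rim (next c))) (prev-next c) (E-sym G e))

  gap-bridged : ∀ {h h̄} → HubPair h h̄ → ∀ c → RimEdge c ⊎ Bridge h c
  gap-bridged hp c with gap-start-spoke hp c | gap-end-spoke hp c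
  ... | inj₁ c∼h | inj₁ c⁺∼h = inj₂ (c∼h , c⁺∼h)
  ... | inj₂ e   | _         = inj₁ e
  ... | _        | inj₂ e    = inj₁ e

  hub-rim-neighbour : ∀ {h h̄} → HubPair h h̄ → ∀ q → ∃ λ z → E G h (rim z) × z ≢ q
  hub-rim-neighbour {h} {h̄} hp q
    with neighbour-avoiding G conn {h} {rim (next q)} {h̄} {rim q}
           (λ h≡ → rim≢hub hp (sym h≡)) (hubPair-distinct hp) (λ h≡ → rim≢hub hp (sym h≡))
           (rim≢hub (hubPair-swap hp)) (rim-≢ (next≢self q))
  ... | w , e , w≢h̄ , w≢q with vertex-cases hp w
  ... | inj₁ refl              = contradiction e (irrefl G)
  ... | inj₂ (inj₁ w≡h̄)       = contradiction w≡h̄ w≢h̄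
  ... | inj₂ (inj₂ (z , refl)) = z , e , λ z≡q → w≢q (cong rim z≡q)

  hub-edge-or-rim-neighbour : ∀ {h h̄} → HubPair h h̄ → ∀ q q' →
                              E G h h̄ ⊎ ∃ λ z → E G h (rim z) × z ≢ q × z ≢ q'
  hub-edge-or-rim-neighbour {h} {h̄} hp q q'
    with neighbour-avoiding G conn {h} {h̄} {rim q} {rim q'}
           (hubPair-distinct hp) (λ h≡ → rim≢hub hp (sym h≡)) (λ h≡ → rim≢hub hp (sym h≡))
           (λ h̄≡ → rim≢hub (hubPair-swap hp) (sym h̄≡)) (λ h̄≡ → rim≢hub (hubPair-swap hp) (sym h̄≡))
  ... | w , e , w≢q , w≢q' with vertex-cases hp w
  ... | inj₁ refl              = contradiction e (irrefl G)
  ... | inj₂ (inj₁ refl)       = inj₁ e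
  ... | inj₂ (inj₂ (z , refl)) = inj₂ (z , e , (λ z≡q → w≢q (cong rim z≡q)) , λ z≡q' → w≢q' (cong rim z≡q'))

  Between : Fin M → Fin M → Fin n → Set
  Between i j hub₀    = ⊥
  Between i j hub₁    = ⊥
  Between i j (rim p) = i Fin.< p × p Fin.≤ j

  between? : ∀ i j → Decidable (Between i j)
  between? i j hub₀    = no λ ()
  between? i j hub₁    = no λ ()
  between? i j (rim p) = (toℕ i <? toℕ p) ×-dec (toℕ p ≤? toℕ j)

  last-between : ∀ {i j p} → i Fin.< p → p Fin.≤ j → ¬ Between i j (rim (next p)) → p ≡ j
  last-between {i} {j} {p} i<p p≤j p⁺∉ with toℕ p <? toℕ j
  ... | no p≮j = toℕ-injective (≤-antisym p≤j (≮⇒≥ p≮j))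
  ... | yes p<j with toℕ-next-cases p
  ...   | inj₁ (_ , p⁺≡1+p) = contradiction (subst (toℕ i <_) (sym p⁺≡1+p) (m<n⇒m<1+n i<p) ,
                                             subst (_≤ toℕ j) (sym p⁺≡1+p) p<j) p⁺∉
  ...   | inj₂ (1+p≡M , _)   = contradiction (<-≤-trans (toℕ<n j) (subst (_≤ toℕ j) 1+p≡M p<j)) (<-irrefl refl)

  first-between : ∀ {i j p} → i Fin.< next p → next p Fin.≤ j → ¬ Between i j (rim p) → p ≡ i
  first-between {i} {j} {p} i<p⁺ p⁺≤j p∉ with toℕ-next-cases p
  ... | inj₂ (_ , p⁺≡0)   = contradiction (subst (toℕ i <_) p⁺≡0 i<p⁺) n≮0
  ... | inj₁ (_ , p⁺≡1+p) = toℕ-injective (≤-antisym (≮⇒≥ (λ i<p → p∉ (i<p , p≤j))) i≤p)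
    where
    i≤p : toℕ i ≤ toℕ p
    i≤p = ≤-pred (subst (toℕ i <_) p⁺≡1+p i<p⁺)
    p≤j : toℕ p ≤ toℕ j
    p≤j = ≤-trans (n≤1+n (toℕ p)) (subst (_≤ toℕ j) p⁺≡1+p p⁺≤j)

  -- A walk from rim j to rim i avoiding the hubs has to leave the positions in (i, j],
  -- and it can only do so along the rim edge at i or at j.
  rim-gaps-ordered : ∀ {i j} → i Fin.< j → RimEdge i ⊎ RimEdge j
  rim-gaps-ordered {i} {j} i<j
    with reach-exit G (between? i j) (conn hub₀ hub₁ (rim j) (rim i) (λ ()) (λ ()) (λ ()) (λ ()))
                    (i<j , ≤-refl) (λ (i<i , _) → <-irrefl refl i<i)
  ... | hub₀  , _      , ()        , _
  ... | hub₁  , _      , ()        , _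
  ... | rim _ , hub₀   , _         , _   , (≢hub₀ , _) , _ = contradiction refl ≢hub₀
  ... | rim _ , hub₁   , _         , _   , (_ , ≢hub₁) , _ = contradiction refl ≢hub₁
  ... | rim p , rim p' , (i<p , p≤j) , p'∉ , _ , e with bicycle-rim⁻ (sub _ _ e)
  ...   | inj₁ refl = inj₂ (subst RimEdge (last-between i<p p≤j p'∉) e)
  ...   | inj₂ refl = inj₁ (subst RimEdge (first-between i<p p≤j p'∉) (E-sym G e))

  rim-gap-unique : ∀ i j → i ≢ j → RimEdge i ⊎ RimEdge j
  rim-gap-unique i j i≢j with <-cmp (toℕ i) (toℕ j)
  ... | tri< i<j _ _ = rim-gaps-ordered i<j
  ... | tri≈ _ i≡j _ = contradiction (toℕ-injective i≡j) i≢j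
  ... | tri> _ _ j<i = swap (rim-gaps-ordered j<i)

  switch-between : ∀ {p q} → E G (rim p) hub₀ → E G (rim q) hub₁ → p ≢ q → ∃ λ a → Switch a × a ≢ q
  switch-between {p} {q} p∼h₀ q∼h₁ p≢q with split-offset p q p≢q
  ... | L₁ , L₂ , M≡ , refl
    with first-crossing {λ j → E G (rim (p ⊕ j)) hub₀} {λ j → E G (rim (p ⊕ j)) hub₁}
           (λ j → spoke (p ⊕ j)) (subst (λ t → E G (rim t) hub₀) (sym (⊕-identityʳ p)) p∼h₀) L₁ q∼h₁
  ... | j , j≤L₁ , a∼h₀ , a⁺∼h₁ =
    p ⊕ j , (a∼h₀ , subst (λ t → E G (rim t) hub₁) (⊕-suc p j) a⁺∼h₁) ,
    ⊕-≢ p (<-trans (s≤s j≤L₁) 1+L₁<M) 1+L₁<M (<⇒≢ (s≤s j≤L₁))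
    where
    1+L₁<M : suc L₁ < M
    1+L₁<M = subst (suc L₁ <_) M≡ (m<m+n (suc L₁) (s≤s z≤n))

  one-rim-gap⇒hamiltonian : ∀ c → (∀ p → p ≢ c → RimEdge p) → Bridge hub₀ c → Bridge hub₁ c → Hamiltonian G
  one-rim-gap⇒hamiltonian c rim-ok (c∼h₀ , c⁺∼h₀) (c∼h₁ , c⁺∼h₁) with switch-between c⁺∼h₀ c∼h₁ (next≢self c)
  ... | a , switch-a , a≢c =
    two-switches⇒hamiltonian c a (≢-sym a≢c) (c∼h₀ , c⁺∼h₁) switch-a (λ p p≢c _ → rim-ok p p≢c)

  switch-or-bridge-before : ∀ {z} → E G hub₁ (rim z) → Switch (prev z) ⊎ Bridge hub₁ (prev z)
  switch-or-bridge-before {z} h₁∼z = map (_, z⁻⁺∼h₁) (_, z⁻⁺∼h₁) (spoke (prev z))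
    where
    z⁻⁺∼h₁ : E G (rim (next (prev z))) hub₁
    z⁻⁺∼h₁ = subst (λ t → E G (rim t) hub₁) (sym (next-prev z)) (E-sym G h₁∼z)

  switch-or-bridge-after : ∀ {w} → E G hub₀ (rim w) → Switch w ⊎ Bridge hub₀ w
  switch-or-bridge-after {w} h₀∼w = swap (map (E-sym G h₀∼w ,_) (E-sym G h₀∼w ,_) (spoke (next w)))

  -- Unless the hubs are adjacent, each has a rim neighbour away from i and i+1: z for hub₁
  -- and w for hub₀.  The rim vertices just before z and just after w then give a second
  -- switch or two opposite bridges.
  complete-rim-with-switch⇒hamiltonian : (∀ p → RimEdge p) → ∀ i → Switch i → Hamiltonian G
  complete-rim-with-switch⇒hamiltonian rim-ok i switch-i
    with hub-edge-or-rim-neighbour hubs₁₀ i (next i) | hub-edge-or-rim-neighbour hubs₀₁ i (next i)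
  ... | inj₁ h₁∼h₀ | _          = switch+hub-edge⇒hamiltonian i switch-i (E-sym G h₁∼h₀) (λ p _ _ → rim-ok p)
  ... | inj₂ _     | inj₁ h₀∼h₁ = switch+hub-edge⇒hamiltonian i switch-i h₀∼h₁ (λ p _ _ → rim-ok p)
  ... | inj₂ (z , h₁∼z , _ , z≢i⁺) | inj₂ (w , h₀∼w , w≢i , _)
    with switch-or-bridge-before h₁∼z | switch-or-bridge-after h₀∼w
  ... | inj₁ switch-z⁻ | _ = two-switches⇒hamiltonian i (prev z) (≢-prev z≢i⁺) switch-i switch-z⁻ (λ p _ _ → rim-ok p)
  ... | inj₂ _ | inj₁ switch-w = two-switches⇒hamiltonian i w (≢-sym w≢i) switch-i switch-w (λ p _ _ → rim-ok p)
  ... | inj₂ bridge₁ | inj₂ bridge₀ with prev z ≟ w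
  ...   | yes refl = two-switches⇒hamiltonian i (prev z) (≢-prev z≢i⁺) switch-i (proj₁ bridge₀ , proj₂ bridge₁) (λ p _ _ → rim-ok p)
  ...   | no z⁻≢w  = opposite-bridges⇒hamiltonian (prev z) w z⁻≢w bridge₁ bridge₀ (λ p _ _ → rim-ok p)

  complete-rim⇒hamiltonian : (∀ p → RimEdge p) → Hamiltonian G
  complete-rim⇒hamiltonian rim-ok with hub-rim-neighbour hubs₁₀ fzero
  ... | y , h₁∼y , _ with hub-rim-neighbour hubs₀₁ y
  ... | w , h₀∼w , w≢y with switch-between (E-sym G h₀∼w) (E-sym G h₁∼y) w≢y
  ... | i , switch-i , _ = complete-rim-with-switch⇒hamiltonian rim-ok i switch-i

  fill-gap : ∀ {c} → (∀ p → p ≢ c → RimEdge p) → RimEdge c → ∀ p → RimEdge p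
  fill-gap {c} rim-ok c-edge p with p ≟ c
  ... | yes refl = c-edge
  ... | no p≢c   = rim-ok p p≢c

  hamiltonian : Hamiltonian G
  hamiltonian with pairwise-⊎⇒all-but-one RimEdge rim-gap-unique
  ... | c , rim-ok with gap-bridged hubs₀₁ c | gap-bridged hubs₁₀ c
  ... | inj₂ bridge₀ | inj₂ bridge₁ = one-rim-gap⇒hamiltonian c rim-ok bridge₀ bridge₁
  ... | inj₁ c-edge  | _            = complete-rim⇒hamiltonian (fill-gap rim-ok c-edge)
  ... | _            | inj₁ c-edge  = complete-rim⇒hamiltonian (fill-gap rim-ok c-edge)

bicycle⇒hamiltonian : ∀ k (G : Graph (suc (suc (suc (suc (suc k)))))) → IsBicycle G → Hamiltonian G
bicycle⇒hamiltonian k G isB =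
  switch+hub-edge⇒hamiltonian fzero
    (edge (rim fzero) hub₀ (spokeʳ z≤n ≤-refl) , edge (rim (next fzero)) hub₁ (spokeʳ ≤-refl (s≤s (s≤s z≤n))))
    (edge hub₀ hub₁ hub01) (λ p _ _ → edge (rim p) (rim (next p)) (bicycle-rim p))
  where
  open OnWheel k G
  edge : ∀ u v → BEdge n u v → E G u v
  edge u v = proj₂ (isB u v)

lemma6 : (n : ℕ) → 5 ≤ n → (G : Graph n) →
         IsBicycle G ⊎ (SubgraphOfBicycle G × ThreeConnected G × ¬ Planar G) →
         Hamiltonian G
lemma6 _ (s≤s (s≤s (s≤s (s≤s (s≤s (z≤n {k})))))) G (inj₁ isB) = bicycle⇒hamiltonian k G isB
lemma6 _ (s≤s (s≤s (s≤s (s≤s (s≤s (z≤n {k})))))) G (inj₂ (sub , (_ , conn) , _)) =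
  ThreeConnectedSubgraph.hamiltonian k G sub conn
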